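{- Let $G$ be a hypo-efficient domination graph. Then $|V(G)|\leq\gamma(G)(\Delta(G)+1)-1$. (i) Suppose equality holds. Then (a) for every $\gamma$-set $D$ of $G$ there is exactly one vertex $y_D\in V(G)\setminus D$ such that $D$ is an efficient dominating set of $G-y_D$, and $y_D$ is adjacent to exactly $2$ vertices of $D$; and (b) every vertex belonging to some $\gamma$-set of $G$ has degree $\Delta(G)$. In particular, if every vertex of $G$ belongs to some $\gamma$-set of $G$, then $G$ is regular. (ii) If there exist a $\gamma$-set $D$ of $G$ and a vertex $y\in V(G)\setminus D$ such that $D$ is an efficient dominating set of $G-y$, $y$ is adjacent to exactly $2$ vertices of $D$, and all vertices of $D$ have degree $\Delta(G)$ in $G$, then $|V(G)|=\gamma(G)(\Delta(G)+1)-1$.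
   Context: All graphs are finite, simple and undirected; $\Delta(G)$ is the maximum degree. A dominating set of $G$ is a set $D\subseteq V(G)$ such that every vertex not in $D$ has a neighbor in $D$; $\gamma(G)$ is the minimum size of a dominating set, and a dominating set of size $\gamma(G)$ is a $\gamma$-set. An efficient dominating set (EDS) of $G$ is a set $D\subseteq V(G)$ with $|N[v]\cap D|=1$ for every $v\in V(G)$, where $N[v]$ is the closed neighborhood of $v$. A graph $G$ is a hypo-efficient domination graph if $G$ has no EDS but $G-v$ has at least one EDS for every $v\in V(G)$. -}

module Defs where

open import Data.Nat using (ℕ; zero; suc; _≤_; _⊔_)
open import Data.Bool using (Bool; true; false; if_then_else_)
open import Data.Fin using (Fin; punchIn; _≟_)
open import Data.Fin.Subset using (Subset; ∣_∣; _∩_; inside; outside; _∈_; _∉_)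
open import Data.Vec using (tabulate; lookup)
open import Data.List using (foldr; map; allFin)
open import Data.Product using (Σ; _×_)
open import Relation.Binary.PropositionalEquality using (_≡_)
open import Relation.Nullary using (¬_; does)

record Graph (n : ℕ) : Set where
  field
    adj    : Fin n → Fin n → Bool
    sym    : ∀ u v → adj u v ≡ adj v u
    irrefl : ∀ v → adj v v ≡ false

open Graph public

N : ∀ {n} → Graph n → Fin n → Subset n
N G v = tabulate (λ u → adj G v u)

N[_,_] : ∀ {n} → Graph n → Fin n → Subset n
N[ G , v ] = tabulate (λ u → if adj G v u then inside else (if does (v ≟ u) then inside else outside))

degree : ∀ {n} → Graph n → Fin n → ℕ
degree G v = ∣ N G v ∣

-- maximum degree Δ(G) (0 for the empty graph)
Δ : ∀ {n} → Graph n → ℕ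
Δ {n} G = foldr _⊔_ 0 (map (degree G) (allFin n))

Regular : ∀ {n} → Graph n → Set
Regular G = ∀ u v → degree G u ≡ degree G v

IsDominating : ∀ {n} → Graph n → Subset n → Set
IsDominating G D = ∀ v → v ∉ D → Σ _ (λ u → u ∈ D × adj G v u ≡ true)

IsDominationNumber : ∀ {n} → Graph n → ℕ → Set
IsDominationNumber G k =
  Σ _ (λ D → IsDominating G D × ∣ D ∣ ≡ k) × (∀ D → IsDominating G D → k ≤ ∣ D ∣)

-- D is a γ-set of G, given that γ is the domination number of G
IsGammaSet : ∀ {n} → Graph n → ℕ → Subset n → Set
IsGammaSet G γ D = IsDominating G D × ∣ D ∣ ≡ γ

IsEDS : ∀ {n} → Graph n → Subset n → Set
IsEDS G D = ∀ v → ∣ N[ G , v ] ∩ D ∣ ≡ 1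

HasEDS : ∀ {n} → Graph n → Set
HasEDS G = Σ _ (λ D → IsEDS G D)

-- vertex-deleted subgraph G - v (vertices of G - v are Fin m, embedded
-- into Fin (suc m) by punchIn v, which skips v)
_─_ : ∀ {n} → Graph n → Fin n → Graph (Data.Nat.pred n)
_─_ {suc m} G v = record
  { adj    = λ i j → adj G (punchIn v i) (punchIn v j)
  ; sym    = λ i j → sym G (punchIn v i) (punchIn v j)
  ; irrefl = λ i → irrefl G (punchIn v i)
  }

-- a subset D ⊆ V(G) with y ∉ D, regarded as a subset of V(G - y)
restrict : ∀ {n} → (y : Fin n) → Subset n → Subset (Data.Nat.pred n)
restrict {suc m} y D = tabulate (λ i → lookup D (punchIn y i))

IsEDSOfMinus : ∀ {n} → Graph n → Fin n → Subset n → Set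
IsEDSOfMinus G y D = y ∉ D × IsEDS (G ─ y) (restrict y D)

HypoEfficient : ∀ {n} → Graph n → Set
HypoEfficient G = ¬ HasEDS G × (∀ v → HasEDS (G ─ v))

-- Double counting: for any D, the numbers |N[v] ∩ D| sum to Σ_{u ∈ D} (deg u + 1) ≤ |D| (Δ + 1).
-- If D is dominating every term is at least 1, and all terms are 1 exactly when D is efficient;
-- since G has no EDS, a γ-set gives n < Σ_v |N[v] ∩ D| ≤ γ (Δ + 1). In the extremal case the sum
-- is n + 1 = γ (Δ + 1): every vertex of D has degree Δ, and exactly one vertex y is dominated twice.
-- This y lies outside D (a second vertex of D in N[y] would itself be dominated twice), so D is an
-- EDS of G - y. Conversely, the hypotheses of (ii) force the sum to be both n + 1 and γ (Δ + 1).
module Submission where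

open import Defs hiding (sym)
open import Data.Nat using (ℕ; zero; suc; _≤_; _<_; _<?_; _*_; _+_; _∸_; _⊔_; z≤n; s≤s)
open import Data.Nat.Properties
  using ( +-*-semiring; ≤-reflexive; ≤-trans; ≤-antisym; <-≤-trans; ≤-<-trans; ≤∧≢⇒<; <⇒≱; ≮⇒≥
        ; +-mono-≤; +-monoʳ-≤; +-monoˡ-≤; *-monoˡ-≤; +-comm; *-comm; *-zeroʳ; m≤m+n; m≤m⊔n; m≤n⊔m
        ; +-cancelˡ-≡; +-cancelʳ-≡; +-cancelˡ-≤; +-cancelʳ-≤; +-cancelˡ-<; *-cancelʳ-≡
        ; m≤n+m∸n; pred[m∸n]≡m∸[1+n]; <⇒≤pred; module ≤-Reasoning )
open import Data.Bool using (Bool; true; false; _∧_; if_then_else_)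
open import Data.Fin using (Fin; zero; suc; punchIn; punchOut; _≟_)
open import Data.Fin.Properties using (punchInᵢ≢i; punchIn-punchOut; punchIn-injective)
open import Data.Fin.Subset using (Subset; ∣_∣; _∩_; _∈_; _∉_)
open import Data.Fin.Subset.Properties using (_∈?_)
open import Data.Vec using ([]; _∷_; lookup)
open import Data.Vec.Properties using (lookup∘tabulate; lookup-zipWith; []=⇒lookup; lookup⇒[]=)
open import Data.List using (List; foldr) renaming (_∷_ to _∷ᴸ_)
open import Data.List.Membership.Propositional using () renaming (_∈_ to _∈ᴸ_)
open import Data.List.Membership.Propositional.Properties using (∈-map⁺; ∈-allFin)
open import Data.List.Relation.Unary.Any using (here; there)
open import Data.Product using (Σ; ∃; _×_; _,_; proj₁; proj₂; uncurry)
open import Data.Empty using (⊥-elim)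
open import Function using (_∘_)
open import Relation.Nullary using (¬_; yes; no; does; contradiction)
open import Relation.Nullary.Decidable using (dec-true; dec-false)
open import Relation.Binary.PropositionalEquality
  using (_≡_; _≢_; refl; sym; trans; cong; cong₂; subst; subst₂; module ≡-Reasoning)
open import Algebra.Properties.Semiring.Sum +-*-semiring
  using (sum; sum-syntax; sum-remove; sum-replicate-zero; sum-cong-≗; ∑-comm; *-distribˡ-sum; *-distribʳ-sum)

+-mono-≤-≡⇒≡ : ∀ {a b c d} → a ≤ c → b ≤ d → a + b ≡ c + d → a ≡ c × b ≡ d
+-mono-≤-≡⇒≡ {a} {b} {c} {d} a≤c b≤d eq = a≡c , +-cancelˡ-≡ c b d (subst (λ x → x + b ≡ c + d) a≡c eq)
  where
  a≡c : a ≡ c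
  a≡c = ≤-antisym a≤c (+-cancelʳ-≤ b c a (≤-trans (+-monoʳ-≤ c b≤d) (≤-reflexive (sym eq))))

<⇒≤∸1 : ∀ {a b} → a < b → a ≤ b ∸ 1
<⇒≤∸1 {a} {b} a<b = subst (a ≤_) (pred[m∸n]≡m∸[1+n] b 0) (<⇒≤pred a<b)

<-≤-≡∸1⇒≡ : ∀ {a b c} → a < b → b ≤ c → a ≡ c ∸ 1 → b ≡ suc a × c ≡ suc a
<-≤-≡∸1⇒≡ {a} {b} {c} a<b b≤c a≡c∸1 = ≤-antisym (≤-trans b≤c c≤1+a) a<b , ≤-antisym c≤1+a (≤-trans a<b b≤c)
  where
  c≤1+a : c ≤ suc a
  c≤1+a = subst (c ≤_) (cong suc (sym a≡c∸1)) (m≤n+m∸n c 1)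

∑-const-1 : ∀ n → ∑[ i < n ] 1 ≡ n
∑-const-1 zero    = refl
∑-const-1 (suc n) = cong suc (∑-const-1 n)

∑-mono-≤ : ∀ {n} {f g : Fin n → ℕ} → (∀ i → f i ≤ g i) → sum f ≤ sum g
∑-mono-≤ {zero}  f≤g = z≤n
∑-mono-≤ {suc n} f≤g = +-mono-≤ (f≤g zero) (∑-mono-≤ (λ i → f≤g (suc i)))

∑-mono-≤-≡⇒≗ : ∀ {n} {f g : Fin n → ℕ} → (∀ i → f i ≤ g i) → sum f ≡ sum g → ∀ i → f i ≡ g i
∑-mono-≤-≡⇒≗ {suc n} f≤g eq zero    =
  let (f₀≡g₀ , _) = +-mono-≤-≡⇒≡ (f≤g zero) (∑-mono-≤ (λ i → f≤g (suc i))) eq in f₀≡g₀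
∑-mono-≤-≡⇒≗ {suc n} f≤g eq (suc i) =
  let (_ , tail≡) = +-mono-≤-≡⇒≡ (f≤g zero) (∑-mono-≤ (λ i → f≤g (suc i))) eq
  in ∑-mono-≤-≡⇒≗ (λ i → f≤g (suc i)) tail≡ i

∑<∑⇒∃< : ∀ {n} (f g : Fin n → ℕ) → sum f < sum g → ∃ λ i → f i < g i
∑<∑⇒∃< {zero}  f g ()
∑<∑⇒∃< {suc n} f g lt with f zero <? g zero
... | yes f₀<g₀ = zero , f₀<g₀
... | no  f₀≮g₀ =
  let (i , fi<gi) = ∑<∑⇒∃< (λ i → f (suc i)) (λ i → g (suc i))
                       (+-cancelˡ-< (g zero) _ _ (≤-<-trans (+-monoˡ-≤ _ (≮⇒≥ f₀≮g₀)) lt))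
  in suc i , fi<gi

f≤∑f : ∀ {n} (f : Fin n → ℕ) i → f i ≤ sum f
f≤∑f {suc n} f i = subst (f i ≤_) (sym (sum-remove f)) (m≤m+n (f i) _)

f+f≤∑f : ∀ {n} (f : Fin n → ℕ) {i j} → i ≢ j → f i + f j ≤ sum f
f+f≤∑f {suc n} f {i} {j} i≢j = subst (f i + f j ≤_) (sym (sum-remove f))
  (+-monoʳ-≤ (f i) (subst (λ k → f k ≤ _) (punchIn-punchOut i≢j) (f≤∑f (λ k → f (punchIn i k)) (punchOut i≢j))))

χ : Bool → ℕ
χ true  = 1
χ false = 0

χ-∧ : ∀ x y → χ (x ∧ y) ≡ χ x * χ y
χ-∧ true  true  = refl
χ-∧ true  false = refl
χ-∧ false _     = refl

∣p∣≡∑χ : ∀ {n} (p : Subset n) → ∣ p ∣ ≡ ∑[ i < n ] χ (lookup p i)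
∣p∣≡∑χ []          = refl
∣p∣≡∑χ (true  ∷ p) = cong suc (∣p∣≡∑χ p)
∣p∣≡∑χ (false ∷ p) = ∣p∣≡∑χ p

∣p∩q∣≡∑χ*χ : ∀ {n} (p q : Subset n) → ∣ p ∩ q ∣ ≡ ∑[ i < n ] (χ (lookup p i) * χ (lookup q i))
∣p∩q∣≡∑χ*χ p q = trans (∣p∣≡∑χ (p ∩ q))
  (sum-cong-≗ λ i → trans (cong χ (lookup-zipWith _∧_ i p q)) (χ-∧ (lookup p i) (lookup q i)))

∑c*χ≡∣p∣*c : ∀ {n} (c : ℕ) (p : Subset n) → ∑[ i < n ] (c * χ (lookup p i)) ≡ ∣ p ∣ * c
∑c*χ≡∣p∣*c c p = begin
  ∑[ i < _ ] (c * χ (lookup p i)) ≡⟨ sym (*-distribˡ-sum c (λ i → χ (lookup p i))) ⟩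
  c * ∑[ i < _ ] χ (lookup p i)   ≡⟨ cong (c *_) (sym (∣p∣≡∑χ p)) ⟩
  c * ∣ p ∣                       ≡⟨ *-comm c ∣ p ∣ ⟩
  ∣ p ∣ * c                       ∎
  where open ≡-Reasoning

∈⇒χ≡1 : ∀ {n} {p : Subset n} {i} → i ∈ p → χ (lookup p i) ≡ 1
∈⇒χ≡1 i∈p = cong χ ([]=⇒lookup i∈p)

∉⇒χ≡0 : ∀ {n} {p : Subset n} {i} → i ∉ p → χ (lookup p i) ≡ 0
∉⇒χ≡0 {p = p} {i} i∉p with lookup p i in eq
... | true  = ⊥-elim (i∉p (lookup⇒[]= i p eq))
... | false = refl

∉⇒*χ≡0 : ∀ {n} {p : Subset n} {i} → i ∉ p → ∀ a → a * χ (lookup p i) ≡ 0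
∉⇒*χ≡0 i∉p a = trans (cong (a *_) (∉⇒χ≡0 i∉p)) (*-zeroʳ a)

closedAdj : ∀ {n} → Graph n → Fin n → Fin n → Bool
closedAdj G v u = lookup N[ G , v ] u

closedAdj-unfold : ∀ {n} (G : Graph n) v u →
  closedAdj G v u ≡ (if adj G v u then true else (if does (v ≟ u) then true else false))
closedAdj-unfold G v u = lookup∘tabulate _ u

closedAdj-self : ∀ {n} (G : Graph n) v → closedAdj G v v ≡ true
closedAdj-self G v rewrite closedAdj-unfold G v v | irrefl G v | dec-true (v ≟ v) refl = refl

closedAdj-≢ : ∀ {n} (G : Graph n) {v u} → v ≢ u → closedAdj G v u ≡ adj G v u
closedAdj-≢ G {v} {u} v≢u rewrite closedAdj-unfold G v u | dec-false (v ≟ u) v≢u with adj G v u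
... | true  = refl
... | false = refl

closedAdj-sym : ∀ {n} (G : Graph n) v u → closedAdj G v u ≡ closedAdj G u v
closedAdj-sym G v u with v ≟ u
... | yes refl = refl
... | no  v≢u  = trans (closedAdj-≢ G v≢u) (trans (Graph.sym G v u) (sym (closedAdj-≢ G (v≢u ∘ sym))))

closedAdj-─ : ∀ {m} (G : Graph (suc m)) y i j → closedAdj (G ─ y) i j ≡ closedAdj G (punchIn y i) (punchIn y j)
closedAdj-─ G y i j with i ≟ j
... | yes refl = trans (closedAdj-self (G ─ y) i) (sym (closedAdj-self G (punchIn y i)))
... | no  i≢j  = trans (closedAdj-≢ (G ─ y) i≢j) (sym (closedAdj-≢ G (i≢j ∘ punchIn-injective y i j)))

degree≡∑χ : ∀ {n} (G : Graph n) v → degree G v ≡ ∑[ u < n ] χ (adj G v u)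
degree≡∑χ G v = trans (∣p∣≡∑χ (N G v)) (sum-cong-≗ λ u → cong χ (lookup∘tabulate (adj G v) u))

∑χ-closedAdj : ∀ {n} (G : Graph n) v → ∑[ u < n ] χ (closedAdj G v u) ≡ degree G v + 1
∑χ-closedAdj {suc m} G v = begin
  ∑[ u < suc m ] χ (closedAdj G v u)
    ≡⟨ sum-remove {i = v} (λ u → χ (closedAdj G v u)) ⟩
  χ (closedAdj G v v) + ∑[ i < m ] χ (closedAdj G v (punchIn v i))
    ≡⟨ cong₂ _+_ (cong χ (closedAdj-self G v))
                 (sum-cong-≗ λ i → cong χ (closedAdj-≢ G (punchInᵢ≢i v i ∘ sym))) ⟩
  1 + ∑[ i < m ] χ (adj G v (punchIn v i))
    ≡⟨ cong (λ b → 1 + (χ b + ∑[ i < m ] χ (adj G v (punchIn v i)))) (sym (irrefl G v)) ⟩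
  1 + (χ (adj G v v) + ∑[ i < m ] χ (adj G v (punchIn v i)))
    ≡⟨ cong (1 +_) (sym (trans (degree≡∑χ G v) (sum-remove {i = v} (λ u → χ (adj G v u))))) ⟩
  1 + degree G v
    ≡⟨ +-comm 1 (degree G v) ⟩
  degree G v + 1
    ∎
  where open ≡-Reasoning

multiplicity : ∀ {n} → Graph n → Subset n → Fin n → ℕ
multiplicity G D v = ∣ N[ G , v ] ∩ D ∣

multiplicity≡∑ : ∀ {n} (G : Graph n) D v →
  multiplicity G D v ≡ ∑[ u < n ] (χ (closedAdj G v u) * χ (lookup D u))
multiplicity≡∑ G D v = ∣p∩q∣≡∑χ*χ N[ G , v ] D

∑-multiplicity : ∀ {n} (G : Graph n) D →
  sum (multiplicity G D) ≡ ∑[ u < n ] ((degree G u + 1) * χ (lookup D u))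
∑-multiplicity {n} G D = begin
  sum (multiplicity G D)
    ≡⟨ sum-cong-≗ (multiplicity≡∑ G D) ⟩
  ∑[ v < n ] ∑[ u < n ] (χ (closedAdj G v u) * χ (lookup D u))
    ≡⟨ ∑-comm (λ v u → χ (closedAdj G v u) * χ (lookup D u)) ⟩
  ∑[ u < n ] ∑[ v < n ] (χ (closedAdj G v u) * χ (lookup D u))
    ≡⟨ sum-cong-≗ (λ u → sym (*-distribʳ-sum (χ (lookup D u)) (λ v → χ (closedAdj G v u)))) ⟩
  ∑[ u < n ] ((∑[ v < n ] χ (closedAdj G v u)) * χ (lookup D u))
    ≡⟨ sum-cong-≗ (λ u → cong (_* χ (lookup D u)) (trans
         (sum-cong-≗ λ v → cong χ (closedAdj-sym G v u)) (∑χ-closedAdj G u))) ⟩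
  ∑[ u < n ] ((degree G u + 1) * χ (lookup D u))
    ∎
  where open ≡-Reasoning

∈ᴸ⇒≤foldr-⊔ : ∀ {x : ℕ} {xs : List ℕ} → x ∈ᴸ xs → x ≤ foldr _⊔_ 0 xs
∈ᴸ⇒≤foldr-⊔ {x} (here refl)        = m≤m⊔n x _
∈ᴸ⇒≤foldr-⊔ {xs = y ∷ᴸ _} (there p) = ≤-trans (∈ᴸ⇒≤foldr-⊔ p) (m≤n⊔m y _)

degree≤Δ : ∀ {n} (G : Graph n) v → degree G v ≤ Δ G
degree≤Δ G v = ∈ᴸ⇒≤foldr-⊔ (∈-map⁺ (degree G) (∈-allFin v))

weighted-degree≤Δ : ∀ {n} (G : Graph n) D u →
  (degree G u + 1) * χ (lookup D u) ≤ (Δ G + 1) * χ (lookup D u)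
weighted-degree≤Δ G D u = *-monoˡ-≤ (χ (lookup D u)) (+-monoˡ-≤ 1 (degree≤Δ G u))

∑-multiplicity≤∣D∣[Δ+1] : ∀ {n} (G : Graph n) D → sum (multiplicity G D) ≤ ∣ D ∣ * (Δ G + 1)
∑-multiplicity≤∣D∣[Δ+1] {n} G D = begin
  sum (multiplicity G D)                         ≡⟨ ∑-multiplicity G D ⟩
  ∑[ u < n ] ((degree G u + 1) * χ (lookup D u)) ≤⟨ ∑-mono-≤ (weighted-degree≤Δ G D) ⟩
  ∑[ u < n ] ((Δ G + 1) * χ (lookup D u))        ≡⟨ ∑c*χ≡∣p∣*c (Δ G + 1) D ⟩
  ∣ D ∣ * (Δ G + 1)                              ∎
  where open ≤-Reasoning

∑-multiplicity≡∣D∣[Δ+1]⇒degree≡Δ : ∀ {n} (G : Graph n) D → sum (multiplicity G D) ≡ ∣ D ∣ * (Δ G + 1) →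
  ∀ v → v ∈ D → degree G v ≡ Δ G
∑-multiplicity≡∣D∣[Δ+1]⇒degree≡Δ G D eq v v∈D =
  +-cancelʳ-≡ 1 (degree G v) (Δ G) (*-cancelʳ-≡ (degree G v + 1) (Δ G + 1) 1
    (subst (λ c → (degree G v + 1) * c ≡ (Δ G + 1) * c) (∈⇒χ≡1 v∈D) weighted≡))
  where
  weighted≡ : (degree G v + 1) * χ (lookup D v) ≡ (Δ G + 1) * χ (lookup D v)
  weighted≡ = ∑-mono-≤-≡⇒≗ (weighted-degree≤Δ G D)
    (trans (sym (∑-multiplicity G D)) (trans eq (sym (∑c*χ≡∣p∣*c (Δ G + 1) D)))) v

degree≡Δ⇒∑-multiplicity≡∣D∣[Δ+1] : ∀ {n} (G : Graph n) D → (∀ v → v ∈ D → degree G v ≡ Δ G) →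
  sum (multiplicity G D) ≡ ∣ D ∣ * (Δ G + 1)
degree≡Δ⇒∑-multiplicity≡∣D∣[Δ+1] G D degree≡Δ =
  trans (∑-multiplicity G D) (trans (sum-cong-≗ weighted≡) (∑c*χ≡∣p∣*c (Δ G + 1) D))
  where
  weighted≡ : ∀ u → (degree G u + 1) * χ (lookup D u) ≡ (Δ G + 1) * χ (lookup D u)
  weighted≡ u with lookup D u in eq
  ... | true  = cong (λ d → (d + 1) * 1) (degree≡Δ u (lookup⇒[]= u D eq))
  ... | false = trans (*-zeroʳ (degree G u + 1)) (sym (*-zeroʳ (Δ G + 1)))

multiplicity-split : ∀ {m} (G : Graph (suc m)) D v → multiplicity G D v ≡
  χ (closedAdj G v v) * χ (lookup D v) + ∑[ i < m ] (χ (closedAdj G v (punchIn v i)) * χ (lookup D (punchIn v i)))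
multiplicity-split G D v = trans (multiplicity≡∑ G D v) (sum-remove {i = v} (λ u → χ (closedAdj G v u) * χ (lookup D u)))

closedAdj-∈⇒1≤multiplicity : ∀ {n} (G : Graph n) {D v u} → closedAdj G v u ≡ true → u ∈ D →
  1 ≤ multiplicity G D v
closedAdj-∈⇒1≤multiplicity G {D} {v} {u} vu u∈D = subst₂ _≤_
  (cong₂ (λ a b → χ a * b) vu (∈⇒χ≡1 u∈D)) (sym (multiplicity≡∑ G D v))
  (f≤∑f (λ w → χ (closedAdj G v w) * χ (lookup D w)) u)

closedAdj-∈⇒2≤multiplicity : ∀ {n} (G : Graph n) {D u y} → u ≢ y → u ∈ D → y ∈ D →
  closedAdj G u y ≡ true → 2 ≤ multiplicity G D u
closedAdj-∈⇒2≤multiplicity G {D} {u} {y} u≢y u∈D y∈D uy = subst₂ _≤_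
  (cong₂ _+_ (cong₂ (λ a b → χ a * b) (closedAdj-self G u) (∈⇒χ≡1 u∈D))
             (cong₂ (λ a b → χ a * b) uy (∈⇒χ≡1 y∈D)))
  (sym (multiplicity≡∑ G D u))
  (f+f≤∑f (λ w → χ (closedAdj G u w) * χ (lookup D w)) u≢y)

dominating⇒1≤multiplicity : ∀ {n} (G : Graph n) {D} → IsDominating G D → ∀ v → 1 ≤ multiplicity G D v
dominating⇒1≤multiplicity G {D} dom v with v ∈? D
... | yes v∈D = closedAdj-∈⇒1≤multiplicity G (closedAdj-self G v) v∈D
... | no  v∉D =
  let (u , u∈D , vu) = dom v v∉D
      v≢u : v ≢ u
      v≢u v≡u = v∉D (subst (_∈ D) (sym v≡u) u∈D)
  in closedAdj-∈⇒1≤multiplicity G (trans (closedAdj-≢ G v≢u) vu) u∈D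

dominating⇒n≤∑multiplicity : ∀ {n} (G : Graph n) {D} → IsDominating G D → n ≤ sum (multiplicity G D)
dominating⇒n≤∑multiplicity {n} G {D} dom =
  subst (_≤ sum (multiplicity G D)) (∑-const-1 n) (∑-mono-≤ (dominating⇒1≤multiplicity G dom))

∑multiplicity≡n⇒IsEDS : ∀ {n} (G : Graph n) {D} → IsDominating G D → sum (multiplicity G D) ≡ n → IsEDS G D
∑multiplicity≡n⇒IsEDS {n} G dom eq v =
  sym (∑-mono-≤-≡⇒≗ (dominating⇒1≤multiplicity G dom) (trans (∑-const-1 n) (sym eq)) v)

noEDS⇒n<∑multiplicity : ∀ {n} (G : Graph n) {D} → ¬ HasEDS G → IsDominating G D → n < sum (multiplicity G D)
noEDS⇒n<∑multiplicity G {D} noEDS dom = ≤∧≢⇒< (dominating⇒n≤∑multiplicity G dom)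
  (λ eq → noEDS (D , ∑multiplicity≡n⇒IsEDS G dom (sym eq)))

multiplicity-─ : ∀ {m} (G : Graph (suc m)) {y D} → y ∉ D → ∀ i →
  multiplicity (G ─ y) (restrict y D) i ≡ multiplicity G D (punchIn y i)
multiplicity-─ {m} G {y} {D} y∉D i = begin
  multiplicity (G ─ y) (restrict y D) i
    ≡⟨ multiplicity≡∑ (G ─ y) (restrict y D) i ⟩
  ∑[ j < m ] (χ (closedAdj (G ─ y) i j) * χ (lookup (restrict y D) j))
    ≡⟨ sum-cong-≗ (λ j → cong₂ (λ a b → χ a * χ b) (closedAdj-─ G y i j) (lookup∘tabulate _ j)) ⟩
  ∑[ j < m ] (χ (closedAdj G u (punchIn y j)) * χ (lookup D (punchIn y j)))
    ≡⟨ cong (_+ ∑[ j < m ] (χ (closedAdj G u (punchIn y j)) * χ (lookup D (punchIn y j))))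
            (sym (∉⇒*χ≡0 y∉D (χ (closedAdj G u y)))) ⟩
  χ (closedAdj G u y) * χ (lookup D y) + ∑[ j < m ] (χ (closedAdj G u (punchIn y j)) * χ (lookup D (punchIn y j)))
    ≡⟨ sym (trans (multiplicity≡∑ G D u) (sum-remove {i = y} (λ w → χ (closedAdj G u w) * χ (lookup D w)))) ⟩
  multiplicity G D u
    ∎
  where
  u = punchIn y i
  open ≡-Reasoning

multiplicity-∉ : ∀ {n} (G : Graph n) {y D} → y ∉ D → multiplicity G D y ≡ ∣ N G y ∩ D ∣
multiplicity-∉ G {y} {D} y∉D =
  trans (multiplicity≡∑ G D y) (trans (sum-cong-≗ termwise) (sym (∣p∩q∣≡∑χ*χ (N G y) D)))
  where
  termwise : ∀ u → χ (closedAdj G y u) * χ (lookup D u) ≡ χ (lookup (N G y) u) * χ (lookup D u)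
  termwise u with y ≟ u
  ... | yes refl = trans (∉⇒*χ≡0 y∉D (χ (closedAdj G y y))) (sym (∉⇒*χ≡0 y∉D (χ (lookup (N G y) y))))
  ... | no  y≢u  = cong (λ a → χ a * χ (lookup D u)) (trans (closedAdj-≢ G y≢u) (sym (lookup∘tabulate (adj G y) u)))

EDSOfMinus⇒multiplicity≡1 : ∀ {n} (G : Graph n) {y D} → IsEDSOfMinus G y D → ∀ {v} → v ≢ y →
  multiplicity G D v ≡ 1
EDSOfMinus⇒multiplicity≡1 {suc m} G {D = D} (y∉D , eds) {v} v≢y =
  subst (λ w → multiplicity G D w ≡ 1) (punchIn-punchOut (v≢y ∘ sym))
    (trans (sym (multiplicity-─ G y∉D (punchOut (v≢y ∘ sym)))) (eds (punchOut (v≢y ∘ sym))))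

EDSOfMinus⇒∑multiplicity : ∀ {m} (G : Graph (suc m)) {y D} → IsEDSOfMinus G y D →
  sum (multiplicity G D) ≡ multiplicity G D y + m
EDSOfMinus⇒∑multiplicity {m} G {y} {D} (y∉D , eds) =
  trans (sum-remove {i = y} (multiplicity G D)) (cong (multiplicity G D y +_)
    (trans (sum-cong-≗ (λ i → trans (sym (multiplicity-─ G y∉D i)) (eds i))) (∑-const-1 m)))

∑≡1+n⇒single-2 : ∀ {m} (f : Fin (suc m) → ℕ) → (∀ i → 1 ≤ f i) → sum f ≡ suc (suc m) →
  ∃ λ y → f y ≡ 2 × ∀ i → f (punchIn y i) ≡ 1
∑≡1+n⇒single-2 {m} f 1≤f ∑f≡ with ∑<∑⇒∃< (λ _ → 1) f (subst (_< sum f) (sym (∑-const-1 (suc m))) (≤-reflexive (sym ∑f≡)))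
... | y , 1<fy =
  let (2≡fy , ∑1≡rest) = +-mono-≤-≡⇒≡ 1<fy (∑-mono-≤ (λ i → 1≤f (punchIn y i))) split
  in y , sym 2≡fy , λ i → sym (∑-mono-≤-≡⇒≗ (λ i → 1≤f (punchIn y i)) ∑1≡rest i)
  where
  split : 2 + ∑[ i < m ] 1 ≡ f y + ∑[ i < m ] f (punchIn y i)
  split = trans (cong (2 +_) (∑-const-1 m)) (trans (sym ∑f≡) (sum-remove {i = y} f))

χ*χ-positive : ∀ a b → 0 < χ a * χ b → a ≡ true × b ≡ true
χ*χ-positive true  true  _ = refl , refl
χ*χ-positive true  false ()
χ*χ-positive false _     ()

∈-2≤multiplicity⇒closedAdj-∈ : ∀ {m} (G : Graph (suc m)) {D y} → y ∈ D → 2 ≤ multiplicity G D y →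
  ∃ λ j → closedAdj G y (punchIn y j) ≡ true × punchIn y j ∈ D
∈-2≤multiplicity⇒closedAdj-∈ {m} G {D} {y} y∈D 2≤my =
  let (j , 0<term) = ∑<∑⇒∃< (λ _ → 0) term (subst (_< sum term) (sym (sum-replicate-zero m)) 0<∑term)
      (yu , Du)    = χ*χ-positive (closedAdj G y (punchIn y j)) (lookup D (punchIn y j)) 0<term
  in j , yu , lookup⇒[]= (punchIn y j) D Du
  where
  term : Fin m → ℕ
  term j = χ (closedAdj G y (punchIn y j)) * χ (lookup D (punchIn y j))
  0<∑term : 0 < sum term
  0<∑term = +-cancelˡ-≤ 1 1 (sum term) (subst (2 ≤_) (trans (multiplicity-split G D y)
    (cong₂ (λ a b → χ a * b + sum term) (closedAdj-self G y) (∈⇒χ≡1 y∈D))) 2≤my)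

overdominated⇒∉ : ∀ {m} (G : Graph (suc m)) {D y} → 2 ≤ multiplicity G D y →
  (∀ i → multiplicity G D (punchIn y i) ≡ 1) → y ∉ D
overdominated⇒∉ G {y = y} 2≤my rest y∈D =
  let (j , yu , u∈D) = ∈-2≤multiplicity⇒closedAdj-∈ G y∈D 2≤my
      2≤mu = closedAdj-∈⇒2≤multiplicity G (punchInᵢ≢i y j) u∈D y∈D (trans (closedAdj-sym G _ y) yu)
  in <⇒≱ (s≤s (s≤s z≤n)) (subst (2 ≤_) (rest j) 2≤mu)

∑multiplicity≡1+n⇒unique-EDSOfMinus : ∀ {n} (G : Graph n) {D} → IsDominating G D →
  sum (multiplicity G D) ≡ suc n →
  Σ (Fin n) λ y → (y ∉ D × IsEDSOfMinus G y D)
    × (∀ y′ → y′ ∉ D → IsEDSOfMinus G y′ D → y′ ≡ y)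
    × ∣ N G y ∩ D ∣ ≡ 2
∑multiplicity≡1+n⇒unique-EDSOfMinus {zero}  G dom ()
∑multiplicity≡1+n⇒unique-EDSOfMinus {suc m} G {D} dom ∑≡
  with ∑≡1+n⇒single-2 (multiplicity G D) (dominating⇒1≤multiplicity G dom) ∑≡
... | y , my≡2 , rest = y , (y∉D , y∉D , eds) , unique , trans (sym (multiplicity-∉ G y∉D)) my≡2
  where
  y∉D : y ∉ D
  y∉D = overdominated⇒∉ G (≤-reflexive (sym my≡2)) rest
  eds : IsEDS (G ─ y) (restrict y D)
  eds i = trans (multiplicity-─ G y∉D i) (rest i)
  unique : ∀ y′ → y′ ∉ D → IsEDSOfMinus G y′ D → y′ ≡ y
  unique y′ _ eds′ with y′ ≟ y
  ... | yes y′≡y = y′≡y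
  ... | no  y′≢y = contradiction (trans (sym my≡2) (EDSOfMinus⇒multiplicity≡1 G eds′ (y′≢y ∘ sym))) λ ()

EDSOfMinus⇒n≡γ[Δ+1]∸1 : ∀ {n} (G : Graph n) {γ D y} → IsGammaSet G γ D → IsEDSOfMinus G y D →
  ∣ N G y ∩ D ∣ ≡ 2 → (∀ v → v ∈ D → degree G v ≡ Δ G) → n ≡ γ * (Δ G + 1) ∸ 1
EDSOfMinus⇒n≡γ[Δ+1]∸1 {suc m} G {γ} {D} {y} (_ , ∣D∣≡γ) edsMinus ∣Ny∩D∣≡2 degree≡Δ = cong (_∸ 1) (begin
  2 + m                       ≡⟨ cong (_+ m) (sym (trans (multiplicity-∉ G (proj₁ edsMinus)) ∣Ny∩D∣≡2)) ⟩
  multiplicity G D y + m      ≡⟨ sym (EDSOfMinus⇒∑multiplicity G edsMinus) ⟩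
  sum (multiplicity G D)      ≡⟨ degree≡Δ⇒∑-multiplicity≡∣D∣[Δ+1] G D degree≡Δ ⟩
  ∣ D ∣ * (Δ G + 1)           ≡⟨ cong (_* (Δ G + 1)) ∣D∣≡γ ⟩
  γ * (Δ G + 1)               ∎)
  where open ≡-Reasoning

γ-set⇒n<∑multiplicity≤γ[Δ+1] : ∀ {n} (G : Graph n) {γ D} → ¬ HasEDS G → IsGammaSet G γ D →
  n < sum (multiplicity G D) × sum (multiplicity G D) ≤ γ * (Δ G + 1)
γ-set⇒n<∑multiplicity≤γ[Δ+1] G {D = D} noEDS (dom , ∣D∣≡γ) =
  noEDS⇒n<∑multiplicity G noEDS dom ,
  subst (λ k → sum (multiplicity G D) ≤ k * (Δ G + 1)) ∣D∣≡γ (∑-multiplicity≤∣D∣[Δ+1] G D)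

extremal-γ-set : ∀ {n} (G : Graph n) {γ D} → ¬ HasEDS G → n ≡ γ * (Δ G + 1) ∸ 1 → IsGammaSet G γ D →
  sum (multiplicity G D) ≡ suc n × sum (multiplicity G D) ≡ ∣ D ∣ * (Δ G + 1)
extremal-γ-set G noEDS n≡ γD@(_ , ∣D∣≡γ) =
  let (n<∑ , ∑≤) = γ-set⇒n<∑multiplicity≤γ[Δ+1] G noEDS γD
      (∑≡1+n , γ[Δ+1]≡1+n) = <-≤-≡∸1⇒≡ n<∑ ∑≤ n≡
  in ∑≡1+n , trans ∑≡1+n (trans (sym γ[Δ+1]≡1+n) (cong (_* (Δ G + 1)) (sym ∣D∣≡γ)))

extremal⇒degree≡Δ : ∀ {n} (G : Graph n) {γ} → ¬ HasEDS G → n ≡ γ * (Δ G + 1) ∸ 1 →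
  ∀ v → Σ (Subset n) (λ D → IsGammaSet G γ D × v ∈ D) → degree G v ≡ Δ G
extremal⇒degree≡Δ G noEDS n≡ v (D , γD , v∈D) =
  ∑-multiplicity≡∣D∣[Δ+1]⇒degree≡Δ G D (proj₂ (extremal-γ-set G noEDS n≡ γD)) v v∈D

corollary3p10 : ∀ {n} (G : Graph n) (γ : ℕ) → IsDominationNumber G γ → HypoEfficient G →
    (n ≤ γ * (Δ G + 1) ∸ 1)
    × (n ≡ γ * (Δ G + 1) ∸ 1 →
        (∀ D → IsGammaSet G γ D →
          Σ (Fin n) (λ y → (y ∉ D × IsEDSOfMinus G y D)
            × (∀ y′ → y′ ∉ D → IsEDSOfMinus G y′ D → y′ ≡ y)
            × ∣ N G y ∩ D ∣ ≡ 2))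
        × (∀ v → Σ (Subset n) (λ D → IsGammaSet G γ D × v ∈ D) → degree G v ≡ Δ G)
        × ((∀ v → Σ (Subset n) (λ D → IsGammaSet G γ D × v ∈ D)) → Regular G))
    × (∀ D y → IsGammaSet G γ D → y ∉ D → IsEDSOfMinus G y D → ∣ N G y ∩ D ∣ ≡ 2
        → (∀ v → v ∈ D → degree G v ≡ Δ G)
        → n ≡ γ * (Δ G + 1) ∸ 1)
corollary3p10 G γ ((_ , γD₀) , _) (noEDS , _) =
  <⇒≤∸1 (uncurry <-≤-trans (γ-set⇒n<∑multiplicity≤γ[Δ+1] G noEDS γD₀)) ,
  (λ n≡ →
    (λ D γD → ∑multiplicity≡1+n⇒unique-EDSOfMinus G (proj₁ γD) (proj₁ (extremal-γ-set G noEDS n≡ γD))) ,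
    extremal⇒degree≡Δ G noEDS n≡ ,
    λ everyVertexInγSet u v → trans (extremal⇒degree≡Δ G noEDS n≡ u (everyVertexInγSet u))
                                   (sym (extremal⇒degree≡Δ G noEDS n≡ v (everyVertexInγSet v)))) ,
  λ D y γD _ → EDSOfMinus⇒n≡γ[Δ+1]∸1 G γD
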